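{- Let $G=(V,E)$ be a connected graph on $n=n(G)$ vertices with maximum degree $\Delta\geq 2$ and minimum degree $\delta$. Then \[ Z(G)=F_1(G) \leq \frac{(\Delta-2)n - (\Delta-\delta)+2}{\Delta-1}. \]
   Context: All graphs are simple, undirected and finite. For a positive integer $k$, a set $S\subseteq V$ is a $k$-forcing set of $G$ if, when the vertices of $S$ are initially colored and all other vertices are initially non-colored, repeated application of the following color change rule eventually colors all vertices of $G$: a colored vertex with at most $k$ non-colored neighbors causes each of its non-colored neighbors to become colored. The $k$-forcing number $F_k(G)$ is the minimum cardinality of a $k$-forcing set. The zero forcing number is $Z(G)=F_1(G)$. -}

module Defs where

open import Data.Nat using (ℕ; _≤_)
open import Data.Bool using (Bool; true; false; T)
open import Data.Fin using (Fin)
open import Data.Fin.Subset using (Subset; _∈_; _∩_; _∪_; ∁; ∣_∣; ⊤)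
open import Data.Vec using (tabulate)
open import Data.Product using (Σ; _×_; ∃)
open import Relation.Binary.PropositionalEquality using (_≡_)
open import Relation.Binary.Construct.Closure.ReflexiveTransitive using (Star)

record Graph (n : ℕ) : Set where
  field
    adj   : Fin n → Fin n → Bool
    sym   : ∀ u v → adj u v ≡ adj v u
    irrefl : ∀ v → adj v v ≡ false

module _ {n : ℕ} (G : Graph n) where
  open Graph G

  N : Fin n → Subset n
  N v = tabulate (adj v)

  degree : Fin n → ℕ
  degree v = ∣ N v ∣

  IsMaxDegree : ℕ → Set
  IsMaxDegree Δ = (∀ v → degree v ≤ Δ) × ∃ (λ v → degree v ≡ Δ)

  IsMinDegree : ℕ → Set
  IsMinDegree δ = (∀ v → δ ≤ degree v) × ∃ (λ v → degree v ≡ δ)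

  Connected : Set
  Connected = ∀ u v → Star (λ x y → T (adj x y)) u v

  ForceStep : ℕ → Subset n → Subset n → Set
  ForceStep k S S' =
    Σ (Fin n) (λ v → (v ∈ S) × (∣ N v ∩ ∁ S ∣ ≤ k) × (S' ≡ S ∪ N v))

  IsForcingSet : ℕ → Subset n → Set
  IsForcingSet k S = Star (ForceStep k) S ⊤

  IsForcingNumber : ℕ → ℕ → Set
  IsForcingNumber k m =
    Σ (Subset n) (λ S → IsForcingSet k S × ∣ S ∣ ≡ m)
    × (∀ S → IsForcingSet k S → m ≤ ∣ S ∣)

  IsZeroForcingNumber : ℕ → Set
  IsZeroForcingNumber = IsForcingNumber 1

-- Grow a set C of vertices that is certified to be coloured, together with an
-- initial set I that colours it. Start from a vertex v of minimum degree δ, with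
-- C = N[v] and I = N[v] minus one neighbour w, which v then forces. While C ≠ V,
-- connectivity gives u ∈ C with a neighbour w ∉ C; put the k new neighbours of u
-- into C and all of them except w into I: after the old forcing process, u has w
-- as its only uncoloured neighbour and forces it. Since u already has a neighbour
-- in C we have 1 ≤ k ≤ Δ − 1, so (Δ − 1)(k − 1) ≤ (Δ − 2)k and the invariant
-- (Δ − 1)|I| + Δ ≤ (Δ − 2)|C| + δ + 2, tight at the start, survives every step.
-- At C = V it is the claimed bound for the forcing set I.
module Submission where

open import Defs
open import Data.Nat using (ℕ; _≤_; _+_; _*_; _∸_)
open import Data.Nat using (zero; suc; _<_; z≤n; s≤s; s≤s⁻¹; z<s)
open import Data.Nat.Properties
open import Data.Nat.Tactic.RingSolver using (solve-∀)
open import Data.Bool using (true; false; T)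
open import Data.Fin using (Fin)
open import Data.Fin.Subset
open import Data.Fin.Subset.Properties
open import Data.Fin.Properties using (all?; ¬∀⟶∃¬)
open import Data.Vec using (_∷_; [])
open import Data.Vec.Properties using (lookup∘tabulate; []=⇒lookup; lookup⇒[]=)
open import Data.Product using (Σ; _×_; ∃; ∃₂; _,_; proj₁; proj₂)
open import Data.Sum using (inj₁; inj₂)
open import Level using (Level)
open import Algebra.Bundles using (CommutativeMonoid)
import Algebra.Properties.CommutativeSemigroup as CommutativeSemigroupProperties
open import Relation.Unary using (Pred; Decidable)
open import Relation.Binary using (Rel)
open import Relation.Nullary using (¬_; yes; no; contradiction)
open import Relation.Binary.PropositionalEquality
open import Relation.Binary.Construct.Closure.ReflexiveTransitive using (Star; ε; _◅_; _◅◅_)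

private
  variable
    a ℓ r : Level
    n : ℕ

∣p∣≡∣p∩q∣+∣p∩∁q∣ : (p q : Subset n) → ∣ p ∣ ≡ ∣ p ∩ q ∣ + ∣ p ∩ ∁ q ∣
∣p∣≡∣p∩q∣+∣p∩∁q∣ []          []          = refl
∣p∣≡∣p∩q∣+∣p∩∁q∣ (true ∷ p)  (true ∷ q)  = cong suc (∣p∣≡∣p∩q∣+∣p∩∁q∣ p q)
∣p∣≡∣p∩q∣+∣p∩∁q∣ (true ∷ p)  (false ∷ q) = trans (cong suc (∣p∣≡∣p∩q∣+∣p∩∁q∣ p q)) (sym (+-suc _ _))
∣p∣≡∣p∩q∣+∣p∩∁q∣ (false ∷ p) (_ ∷ q)     = ∣p∣≡∣p∩q∣+∣p∩∁q∣ p q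

∣p∪q∣≡∣p∣+∣q∩∁p∣ : (p q : Subset n) → ∣ p ∪ q ∣ ≡ ∣ p ∣ + ∣ q ∩ ∁ p ∣
∣p∪q∣≡∣p∣+∣q∩∁p∣ []          []          = refl
∣p∪q∣≡∣p∣+∣q∩∁p∣ (true ∷ p)  (true ∷ q)  = cong suc (∣p∪q∣≡∣p∣+∣q∩∁p∣ p q)
∣p∪q∣≡∣p∣+∣q∩∁p∣ (true ∷ p)  (false ∷ q) = cong suc (∣p∪q∣≡∣p∣+∣q∩∁p∣ p q)
∣p∪q∣≡∣p∣+∣q∩∁p∣ (false ∷ p) (true ∷ q)  = trans (cong suc (∣p∪q∣≡∣p∣+∣q∩∁p∣ p q)) (sym (+-suc _ _))
∣p∪q∣≡∣p∣+∣q∩∁p∣ (false ∷ p) (false ∷ q) = ∣p∪q∣≡∣p∣+∣q∩∁p∣ p q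

p⊆q⇒∣p∩q∣≡∣p∣ : {p q : Subset n} → p ⊆ q → ∣ p ∩ q ∣ ≡ ∣ p ∣
p⊆q⇒∣p∩q∣≡∣p∣ {p = p} {q} p⊆q =
  cong ∣_∣ (⊆-antisym (p∩q⊆p p q) (λ x∈p → x∈p∩q⁺ (x∈p , p⊆q x∈p)))

x∈p⇒∣p∣≡1+∣p∩∁⁅x⁆∣ : {p : Subset n} {x : Fin n} → x ∈ p → ∣ p ∣ ≡ suc ∣ p ∩ ∁ ⁅ x ⁆ ∣
x∈p⇒∣p∣≡1+∣p∩∁⁅x⁆∣ {p = p} {x} x∈p = begin
  ∣ p ∣                           ≡⟨ ∣p∣≡∣p∩q∣+∣p∩∁q∣ p ⁅ x ⁆ ⟩
  ∣ p ∩ ⁅ x ⁆ ∣ + ∣ p ∩ ∁ ⁅ x ⁆ ∣ ≡⟨ cong (λ m → ∣ m ∣ + ∣ p ∩ ∁ ⁅ x ⁆ ∣) (∩-comm p ⁅ x ⁆) ⟩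
  ∣ ⁅ x ⁆ ∩ p ∣ + ∣ p ∩ ∁ ⁅ x ⁆ ∣ ≡⟨ cong (_+ ∣ p ∩ ∁ ⁅ x ⁆ ∣) (trans (p⊆q⇒∣p∩q∣≡∣p∣ ⁅x⁆⊆p) (∣⁅x⁆∣≡1 x)) ⟩
  suc ∣ p ∩ ∁ ⁅ x ⁆ ∣             ∎
  where
  open ≡-Reasoning
  ⁅x⁆⊆p : ⁅ x ⁆ ⊆ p
  ⁅x⁆⊆p y∈⁅x⁆ = subst (_∈ p) (sym (x∈⁅y⁆⇒x≡y x y∈⁅x⁆)) x∈p

x∈p⇒0<∣p∣ : {p : Subset n} {x : Fin n} → x ∈ p → 0 < ∣ p ∣
x∈p⇒0<∣p∣ x∈p rewrite x∈p⇒∣p∣≡1+∣p∩∁⁅x⁆∣ x∈p = s≤s z≤n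

0<∣p∣⇒Nonempty : (p : Subset n) → 0 < ∣ p ∣ → Nonempty p
0<∣p∣⇒Nonempty {n} p 0<∣p∣ with nonempty? p
... | yes ne = ne
... | no ¬ne = contradiction (trans (cong ∣_∣ (Empty-unique ¬ne)) (∣⊥∣≡0 n)) (>⇒≢ 0<∣p∣)

x∉p⇒∣p∣<n : {p : Subset n} {x : Fin n} → x ∉ p → ∣ p ∣ < n
x∉p⇒∣p∣<n {n = n} {p} {x} x∉p =
  subst (∣ p ∣ <_) (∣⊤∣≡n n) (p⊂q⇒∣p∣<∣q∣ (⊆⊤ , x , ∈⊤ , x∉p))

Star-crossing : {A : Set a} {R : Rel A r} {P : Pred A ℓ} → Decidable P →
  ∀ {x y} → Star R x y → P x → ¬ P y → ∃₂ λ u v → P u × ¬ P v × R u v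
Star-crossing P? ε Px ¬Py = contradiction Px ¬Py
Star-crossing P? (_◅_ {i = x} {j = x′} x∼x′ x′⟶y) Px ¬Py with P? x′
... | yes Px′ = Star-crossing P? x′⟶y Px′ ¬Py
... | no ¬Px′ = x , x′ , Px , ¬Px′ , x∼x′

module _ (G : Graph n) where
  open Graph G using (adj; irrefl) renaming (sym to adj-sym)

  adj⇒∈N : ∀ {u v} → T (adj u v) → v ∈ N G u
  adj⇒∈N {u} {v} uv with adj u v in eq
  ... | true = lookup⇒[]= v (N G u) (trans (lookup∘tabulate (adj u) v) eq)

  ∈N⇒adj : ∀ {u v} → v ∈ N G u → adj u v ≡ true
  ∈N⇒adj {u} {v} v∈Nu = trans (sym (lookup∘tabulate (adj u) v)) ([]=⇒lookup v∈Nu)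

  ∈N-sym : ∀ {u v} → v ∈ N G u → u ∈ N G v
  ∈N-sym {u} {v} v∈Nu = lookup⇒[]= u (N G v)
    (trans (lookup∘tabulate (adj v) u) (trans (adj-sym v u) (∈N⇒adj v∈Nu)))

  N⊆∁⁅v⁆ : ∀ v → N G v ⊆ ∁ ⁅ v ⁆
  N⊆∁⁅v⁆ v {x} x∈Nv = x∉p⇒x∈∁p λ x∈⁅v⁆ → v∉Nv (subst (_∈ N G v) (x∈⁅y⁆⇒x≡y v x∈⁅v⁆) x∈Nv)
    where
    v∉Nv : v ∉ N G v
    v∉Nv v∈Nv with trans (sym (irrefl v)) (∈N⇒adj v∈Nv)
    ... | ()

  connected⇒Nonempty-N : Connected G → ∀ {v} → Nonempty (N G v) → ∀ u → Nonempty (N G u)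
  connected⇒Nonempty-N conn {v} Nv≠∅ u with conn u v
  ... | ε           = Nv≠∅
  ... | uw ◅ _      = _ , adj⇒∈N uw

  Forces : ℕ → Subset n → Subset n → Set
  Forces k = Star (ForceStep G k)

  Colours : ℕ → Subset n → Subset n → Set
  Colours k I C = ∃ λ R → Forces k I R × C ⊆ R

  Forces-∪ : ∀ {k S T} X → Forces k S T → Forces k (S ∪ X) (T ∪ X)
  Forces-∪ X ε = ε
  Forces-∪ {k} {S} X ((v , v∈S , bound , refl) ◅ S′⟶T) =
    (v , p⊆p∪q X v∈S , bound′ , xy∙z≈xz∙y S (N G v) X) ◅ Forces-∪ X S′⟶T
    where
    open CommutativeSemigroupProperties
      (CommutativeMonoid.commutativeSemigroup (∪-commutativeMonoid n)) using (xy∙z≈xz∙y)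
    shrinks : N G v ∩ ∁ (S ∪ X) ⊆ N G v ∩ ∁ S
    shrinks x∈ with x∈p∩q⁻ (N G v) _ x∈
    ... | x∈Nv , x∉S∪X = x∈p∩q⁺ (x∈Nv , p⊆q⇒∁p⊇∁q (p⊆p∪q X) x∉S∪X)
    bound′ : ∣ N G v ∩ ∁ (S ∪ X) ∣ ≤ k
    bound′ = ≤-trans (p⊆q⇒∣p∣≤∣q∣ shrinks) bound

  Colours-⊤⇒IsForcingSet : ∀ {k I} → Colours k I ⊤ → IsForcingSet G k I
  Colours-⊤⇒IsForcingSet (R , I⟶R , ⊤⊆R) = subst (Forces _ _) (⊆-antisym ⊆⊤ ⊤⊆R) I⟶R

  -- After the old process, u's only uncoloured neighbours lie in W, so u forces.
  Colours-extend : ∀ {k I C u} W → Colours k I C → u ∈ C → ∣ W ∣ ≤ k →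
    Colours k (I ∪ (N G u ∩ ∁ C) ∩ ∁ W) (C ∪ N G u)
  Colours-extend {k} {I} {C} {u} W (R , I⟶R , C⊆R) u∈C ∣W∣≤k =
    (R ∪ D) ∪ N G u , Forces-∪ D I⟶R ◅◅ ((u , u∈R∪D , bound , refl) ◅ ε) , covers
    where
    D : Subset n
    D = (N G u ∩ ∁ C) ∩ ∁ W
    u∈R∪D : u ∈ R ∪ D
    u∈R∪D = p⊆p∪q D (C⊆R u∈C)
    uncoloured⊆W : N G u ∩ ∁ (R ∪ D) ⊆ W
    uncoloured⊆W x∈ with x∈p∩q⁻ (N G u) _ x∈
    ... | x∈Nu , x∉R∪D = x∉∁p⇒x∈p λ x∉W → x∈∁p⇒x∉p x∉R∪D (q⊆p∪q R D
      (x∈p∩q⁺ (x∈p∩q⁺ (x∈Nu , x∉p⇒x∈∁p λ x∈C → x∈∁p⇒x∉p x∉R∪D (p⊆p∪q D (C⊆R x∈C))) , x∉W)))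
    bound : ∣ N G u ∩ ∁ (R ∪ D) ∣ ≤ k
    bound = ≤-trans (p⊆q⇒∣p∣≤∣q∣ uncoloured⊆W) ∣W∣≤k
    covers : C ∪ N G u ⊆ (R ∪ D) ∪ N G u
    covers x∈ with x∈p∪q⁻ C (N G u) x∈
    ... | inj₁ x∈C  = p⊆p∪q (N G u) (p⊆p∪q D (C⊆R x∈C))
    ... | inj₂ x∈Nu = q⊆p∪q (R ∪ D) (N G u) x∈Nu

  module Extension {I C : Subset n} {u w : Fin n} (I⊆C : I ⊆ C) (w∈Nu : w ∈ N G u) (w∉C : w ∉ C) where

    D : Subset n
    D = (N G u ∩ ∁ C) ∩ ∁ ⁅ w ⁆

    ∣Nu∩∁C∣≡1+∣D∣ : ∣ N G u ∩ ∁ C ∣ ≡ suc ∣ D ∣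
    ∣Nu∩∁C∣≡1+∣D∣ = x∈p⇒∣p∣≡1+∣p∩∁⁅x⁆∣ (x∈p∩q⁺ (w∈Nu , x∉p⇒x∈∁p w∉C))

    ∣C∪Nu∣≡∣C∣+1+∣D∣ : ∣ C ∪ N G u ∣ ≡ ∣ C ∣ + suc ∣ D ∣
    ∣C∪Nu∣≡∣C∣+1+∣D∣ = trans (∣p∪q∣≡∣p∣+∣q∩∁p∣ C (N G u)) (cong (∣ C ∣ +_) ∣Nu∩∁C∣≡1+∣D∣)

    ∣I∪D∣≡∣I∣+∣D∣ : ∣ I ∪ D ∣ ≡ ∣ I ∣ + ∣ D ∣
    ∣I∪D∣≡∣I∣+∣D∣ = trans (∣p∪q∣≡∣p∣+∣q∩∁p∣ I D) (cong (∣ I ∣ +_) (p⊆q⇒∣p∩q∣≡∣p∣ D⊆∁I))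
      where
      D⊆∁I : D ⊆ ∁ I
      D⊆∁I x∈D = p⊆q⇒∁p⊇∁q I⊆C (proj₂ (x∈p∩q⁻ _ _ (proj₁ (x∈p∩q⁻ _ _ x∈D))))

    I∪D⊆C∪Nu : I ∪ D ⊆ C ∪ N G u
    I∪D⊆C∪Nu x∈ with x∈p∪q⁻ I D x∈
    ... | inj₁ x∈I = p⊆p∪q (N G u) (I⊆C x∈I)
    ... | inj₂ x∈D = q⊆p∪q C (N G u) (proj₁ (x∈p∩q⁻ _ _ (proj₁ (x∈p∩q⁻ _ _ x∈D))))

    Colours-extend¹ : u ∈ C → Colours 1 I C → Colours 1 (I ∪ D) (C ∪ N G u)
    Colours-extend¹ u∈C I↝C = Colours-extend ⁅ w ⁆ I↝C u∈C (≤-reflexive (∣⁅x⁆∣≡1 w))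

    neighbour-∪N : u ∈ C → (∀ {x} → x ∈ C → Nonempty (N G x ∩ (C ∪ N G u))) →
      ∀ {x} → x ∈ C ∪ N G u → Nonempty (N G x ∩ (C ∪ N G u))
    neighbour-∪N u∈C old x∈ with x∈p∪q⁻ C (N G u) x∈
    ... | inj₁ x∈C  = old x∈C
    ... | inj₂ x∈Nu = u , x∈p∩q⁺ (∈N-sym x∈Nu , p⊆p∪q (N G u) u∈C)

invariant-step : ∀ e δ i c j → j ≤ e →
  (1 + e) * i + (2 + e) ≤ e * c + δ + 2 →
  (1 + e) * (i + j) + (2 + e) ≤ e * (c + suc j) + δ + 2
invariant-step e δ i c j j≤e inv = begin
  (1 + e) * (i + j) + (2 + e)           ≡⟨ expand e i j ⟩
  ((1 + e) * i + (2 + e)) + (j + e * j) ≤⟨ +-mono-≤ inv (+-monoˡ-≤ (e * j) j≤e) ⟩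
  (e * c + δ + 2) + (e + e * j)         ≡⟨ collect e c δ j ⟩
  e * (c + suc j) + δ + 2               ∎
  where
  open ≤-Reasoning
  expand : ∀ e i j → (1 + e) * (i + j) + (2 + e) ≡ ((1 + e) * i + (2 + e)) + (j + e * j)
  expand = solve-∀
  collect : ∀ e c δ j → (e * c + δ + 2) + (e + e * j) ≡ e * (c + suc j) + δ + 2
  collect = solve-∀

invariant-base : ∀ e d → (1 + e) * (1 + d) + (2 + e) ≡ e * (1 + suc d) + suc d + 2
invariant-base = solve-∀

module Greedy {n} (G : Graph n) (e : ℕ) (maxDeg : ∀ v → degree G v ≤ 2 + e) (root : Fin n) where

  record Stage (δ : ℕ) : Set where
    field
      I C         : Subset n
      colours     : Colours G 1 I C
      I⊆C         : I ⊆ C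
      root∈C      : root ∈ C
      neighbourIn : ∀ {x} → x ∈ C → Nonempty (N G x ∩ C)
      invariant   : (1 + e) * ∣ I ∣ + (2 + e) ≤ e * ∣ C ∣ + δ + 2

  initial : ∀ {y} → y ∈ N G root → Stage (degree G root)
  initial {y} y∈N = record
    { I = ⁅ root ⁆ ∪ D ; C = ⁅ root ⁆ ∪ N G root
    ; colours = Colours-extend¹ (x∈⁅x⁆ root) (⁅ root ⁆ , ε , ⊆-refl)
    ; I⊆C = I∪D⊆C∪Nu ; root∈C = p⊆p∪q (N G root) (x∈⁅x⁆ root)
    ; neighbourIn = neighbour-∪N (x∈⁅x⁆ root) λ x∈⁅r⁆ →
        y , x∈p∩q⁺ (subst (λ x → y ∈ N G x) (sym (x∈⁅y⁆⇒x≡y root x∈⁅r⁆)) y∈N , q⊆p∪q _ _ y∈N)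
    ; invariant = ≤-reflexive (begin
        (1 + e) * ∣ ⁅ root ⁆ ∪ D ∣ + (2 + e)            ≡⟨ cong (λ i → (1 + e) * i + (2 + e)) ∣I′∣ ⟩
        (1 + e) * (1 + ∣ D ∣) + (2 + e)                 ≡⟨ invariant-base e ∣ D ∣ ⟩
        e * (1 + suc ∣ D ∣) + suc ∣ D ∣ + 2             ≡⟨ cong₂ (λ c d → e * c + d + 2) ∣C′∣ degree≡1+∣D∣ ⟨
        e * ∣ ⁅ root ⁆ ∪ N G root ∣ + degree G root + 2 ∎) }
    where
    open Extension G {I = ⁅ root ⁆} ⊆-refl y∈N (x∈∁p⇒x∉p (N⊆∁⁅v⁆ G root y∈N))
    open ≡-Reasoning
    ∣I′∣ : ∣ ⁅ root ⁆ ∪ D ∣ ≡ 1 + ∣ D ∣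
    ∣I′∣ = trans ∣I∪D∣≡∣I∣+∣D∣ (cong (_+ ∣ D ∣) (∣⁅x⁆∣≡1 root))
    ∣C′∣ : ∣ ⁅ root ⁆ ∪ N G root ∣ ≡ 1 + suc ∣ D ∣
    ∣C′∣ = trans ∣C∪Nu∣≡∣C∣+1+∣D∣ (cong (_+ suc ∣ D ∣) (∣⁅x⁆∣≡1 root))
    degree≡1+∣D∣ : degree G root ≡ suc ∣ D ∣
    degree≡1+∣D∣ = trans (sym (p⊆q⇒∣p∩q∣≡∣p∣ (N⊆∁⁅v⁆ G root))) ∣Nu∩∁C∣≡1+∣D∣

  extend : ∀ {δ} (s : Stage δ) → let open Stage s in ∀ {u w} → u ∈ C → w ∈ N G u → w ∉ C →
    Σ (Stage δ) λ s′ → ∣ C ∣ < ∣ Stage.C s′ ∣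
  extend {δ} s {u} {w} u∈C w∈Nu w∉C = record
    { I = I ∪ D ; C = C ∪ N G u
    ; colours = Colours-extend¹ u∈C colours
    ; I⊆C = I∪D⊆C∪Nu ; root∈C = p⊆p∪q (N G u) root∈C
    ; neighbourIn = neighbour-∪N u∈C λ x∈C →
        let y , y∈ = neighbourIn x∈C ; y∈Nx , y∈C = x∈p∩q⁻ _ _ y∈ in
        y , x∈p∩q⁺ (y∈Nx , p⊆p∪q (N G u) y∈C)
    ; invariant = subst₂ (λ i c → (1 + e) * i + (2 + e) ≤ e * c + δ + 2)
        (sym ∣I∪D∣≡∣I∣+∣D∣) (sym ∣C∪Nu∣≡∣C∣+1+∣D∣)
        (invariant-step e δ (∣ I ∣) (∣ C ∣) (∣ D ∣) ∣D∣≤e invariant) }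
    , subst (∣ C ∣ <_) (sym ∣C∪Nu∣≡∣C∣+1+∣D∣) (m<m+n (∣ C ∣) z<s)
    where
    open Stage s
    open Extension G I⊆C w∈Nu w∉C
    ∣D∣≤e : ∣ D ∣ ≤ e
    ∣D∣≤e = s≤s⁻¹ (s≤s⁻¹ (begin
      2 + ∣ D ∣                       ≤⟨ +-monoˡ-≤ (suc ∣ D ∣) (x∈p⇒0<∣p∣ (proj₂ (neighbourIn u∈C))) ⟩
      ∣ N G u ∩ C ∣ + suc ∣ D ∣       ≡⟨ cong (∣ N G u ∩ C ∣ +_) ∣Nu∩∁C∣≡1+∣D∣ ⟨
      ∣ N G u ∩ C ∣ + ∣ N G u ∩ ∁ C ∣ ≡⟨ ∣p∣≡∣p∩q∣+∣p∩∁q∣ (N G u) C ⟨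
      degree G u                      ≤⟨ maxDeg u ⟩
      2 + e                           ∎))
      where open ≤-Reasoning

  complete : Connected G → ∀ {δ} → Stage δ → Σ (Stage δ) λ s → Stage.C s ≡ ⊤
  complete conn {δ} s₀ = go n s₀ (m≤n+m n _)
    where
    go : ∀ fuel (s : Stage δ) → n ≤ ∣ Stage.C s ∣ + fuel → Σ (Stage δ) λ s → Stage.C s ≡ ⊤
    go fuel s n≤ with all? (_∈? Stage.C s)
    ... | yes all∈C = s , ⊆-antisym ⊆⊤ λ {x} _ → all∈C x
    ... | no ¬all∈C with ¬∀⟶∃¬ n _ (_∈? Stage.C s) ¬all∈C
    ...   | x , x∉C with Star-crossing (_∈? Stage.C s) (conn root x) (Stage.root∈C s) x∉C | fuel
    ...     | _ , _ , _    , _   , _  | zero     =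
      contradiction (subst (n ≤_) (+-identityʳ _) n≤) (<⇒≱ (x∉p⇒∣p∣<n x∉C))
    ...     | _ , _ , u∈C , w∉C , uw | suc fuel =
      let s′ , grows = extend s u∈C (adj⇒∈N G uw) w∉C in
      go fuel s′ (≤-trans n≤ (≤-trans (≤-reflexive (+-suc _ fuel)) (+-monoˡ-≤ fuel grows)))

corollary1 : (n : ℕ) (G : Graph n) (Δ δ z : ℕ) →
    Connected G → IsMaxDegree G Δ → IsMinDegree G δ → 2 ≤ Δ →
    IsZeroForcingNumber G z →
    (Δ ∸ 1) * z + Δ ≤ (Δ ∸ 2) * n + δ + 2
corollary1 n G (suc (suc e)) δ z conn (maxDeg , vmax , deg-vmax) (_ , root , deg-root)
  (s≤s (s≤s z≤n)) (_ , minimal) =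
  begin
  (1 + e) * z + (2 + e)         ≤⟨ +-monoˡ-≤ (2 + e) (*-monoʳ-≤ (1 + e) (minimal I I-forces)) ⟩
  (1 + e) * ∣ I ∣ + (2 + e)     ≤⟨ invariant ⟩
  e * ∣ C ∣ + degree G root + 2 ≡⟨ cong₂ (λ c d → e * c + d + 2) (trans (cong ∣_∣ C≡⊤) (∣⊤∣≡n n)) deg-root ⟩
  e * n + δ + 2                 ∎
  where
  open ≤-Reasoning
  open Greedy G e maxDeg root
  root-neighbour : Nonempty (N G root)
  root-neighbour = connected⇒Nonempty-N G conn
    (0<∣p∣⇒Nonempty (N G vmax) (subst (0 <_) (sym deg-vmax) z<s)) root
  final : Σ (Stage (degree G root)) λ s → Stage.C s ≡ ⊤
  final = complete conn (initial (proj₂ root-neighbour))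
  open Stage (proj₁ final)
  C≡⊤ : C ≡ ⊤
  C≡⊤ = proj₂ final
  I-forces : IsForcingSet G 1 I
  I-forces = Colours-⊤⇒IsForcingSet G (subst (Colours G 1 I) C≡⊤ colours)
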